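{- Let $f,l$ be positive integers with $l$ even, let $N=l^f$, and consider $\pm1$ variables $S_i$ indexed by vectors $i=(x_1,\dots,x_f)\in\{1,\dots,l\}^f$. Let $n_C=f\,l^{f-1}$ be the number of columns, and for integers $M_C$ (one per column $C$) let $$H=\sum_{\text{columns } C}\Bigl(\sum_{i\in C}S_i-M_C\Bigr)^2 .$$ Let $n_{ze}$ be the number of zero energy assignments. If $n_{ze}>0$, then the number of global minima of $H$ equals $n_{ze}$. Moreover, there is an absolute constant $c>0$ such that for any such $f,l$ there exist choices of the integers $M_C$ for which $$n_{ze}\ \ge\ 2^N\Bigl(\frac{c}{f\sqrt l}\Bigr)^{n_C}.$$
   Context: A column $C$ is specified by an integer $b$ with $1\le b\le f$ together with integers $y_a\in\{1,\dots,l\}$ for all $a\neq b$; a variable $i=(x_1,\dots,x_f)$ lies in $C$ if $x_a=y_a$ for all $a\ne b$. Thus each column contains $l$ variables and there are $n_C=f l^{f-1}$ columns. An assignment $S\in\{\pm1\}^N$ is a zero energy assignment if $\sum_{i\in C}S_i=M_C$ for every column $C$. A global minimum is an assignment minimizing $H$. -}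

module Defs where

open import Data.Nat using (ℕ; zero; suc; _≤_; _<_)
open import Data.Bool using (Bool; true; false)
open import Data.Fin using (Fin)
open import Data.Vec using (Vec; []; _∷_; insertAt)
open import Data.List using (List; []; _∷_; map; concatMap; length; filter; allFin)
open import Data.List.Relation.Unary.All using (All; all?)
open import Data.Integer using (ℤ; +_; -[1+_]; _+_; _-_; _*_)
import Data.Integer as ℤ
open import Data.Product using (Σ; _×_; _,_)
open import Data.Empty using (⊥)
open import Relation.Binary.PropositionalEquality using (_≡_)

-- A site i = (x_1,…,x_f) ∈ {1,…,l}^f  (coordinates 0-indexed as Fin l).
Site : ℕ → ℕ → Set
Site f l = Vec (Fin l) f

Assignment : ℕ → ℕ → Set
Assignment f l = Site f l → Bool

spin : Bool → ℤ
spin true  = + 1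
spin false = -[1+ 0 ]

-- A column: direction b together with the f-1 fixed coordinates y_a (a ≠ b).
Column : ℕ → ℕ → Set
Column zero    l = ⊥
Column (suc g) l = Fin (suc g) × Vec (Fin l) g

colSite : ∀ {f l} → Column f l → Fin l → Site f l
colSite {zero}  ()
colSite {suc g} (b , y) x = insertAt y b x

allFuns : ∀ {X : Set} (n : ℕ) → List X → List (Fin n → X)
allFuns zero    xs = (λ ()) ∷ []
allFuns (suc n) xs =
  concatMap (λ x → map (λ g → λ { Fin.zero → x ; (Fin.suc i) → g i }) (allFuns n xs)) xs

allVecs : ∀ {A : Set} (n : ℕ) → List A → List (Vec A n)
allVecs zero    as = [] ∷ []
allVecs (suc n) as = concatMap (λ a → map (a ∷_) (allVecs n as)) as

allSiteFuns : ∀ {X : Set} (f l : ℕ) → List X → List (Site f l → X)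
allSiteFuns zero    l xs = map (λ x → λ _ → x) xs
allSiteFuns (suc f) l xs =
  map (λ g → λ { (a ∷ v) → g a v }) (allFuns l (allSiteFuns f l xs))

allAssignments : (f l : ℕ) → List (Assignment f l)
allAssignments f l = allSiteFuns f l (true ∷ false ∷ [])

allColumns : (f l : ℕ) → List (Column f l)
allColumns zero    l = []
allColumns (suc g) l = concatMap (λ b → map (b ,_) (allVecs g (allFin l))) (allFin (suc g))

sumℤ : List ℤ → ℤ
sumℤ []       = + 0
sumℤ (x ∷ xs) = x + sumℤ xs

colSum : ∀ {f l} → Assignment f l → Column f l → ℤ
colSum {f} {l} S C = sumℤ (map (λ x → spin (S (colSite C x))) (allFin l))

H : ∀ f l → (Column f l → ℤ) → Assignment f l → ℤ
H f l M S = sumℤ (map (λ C → (colSum S C - M C) * (colSum S C - M C)) (allColumns f l))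

ZeroEnergy : ∀ f l → (Column f l → ℤ) → Assignment f l → Set
ZeroEnergy f l M S = All (λ C → colSum S C ≡ M C) (allColumns f l)

GlobalMin : ∀ f l → (Column f l → ℤ) → Assignment f l → Set
GlobalMin f l M S = All (λ S' → H f l M S ℤ.≤ H f l M S') (allAssignments f l)

nZE : ∀ f l → (Column f l → ℤ) → ℕ
nZE f l M = length (filter (λ S → all? (λ C → colSum S C ℤ.≟ M C) (allColumns f l))
                           (allAssignments f l))

nGM : ∀ f l → (Column f l → ℤ) → ℕ
nGM f l M = length (filter (λ S → all? (λ S' → H f l M S ℤ.≤? H f l M S') (allAssignments f l))
                           (allAssignments f l))

-- H is a sum of squares of integers, so H ≥ 0 with equality exactly at the zero energy assignments;
-- when one exists, these are precisely the global minima.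
--
-- Write x_C(S) for the column sums. Distinct spins are uncorrelated over all 2^N assignments, so
-- Σ_S Σ_C x_C(S)² = n_C l 2^N, and by Markov at least half of the assignments have Σ_C x_C² ≤ 2 n_C l.
-- Pick s with l ≤ s² ≤ 4l. For such an assignment the quotients ⌊|x_C|/s⌋ are n_C naturals with sum
-- at most 2 n_C, and each quotient leaves 2s values for x_C, so at most 2^(3 n_C) (2s)^n_C = (16s)^n_C
-- vectors x occur. By pigeonhole one of them, taken as M, is the column-sum vector of at least
-- 2^(N-1) / (16s)^n_C assignments, all of zero energy for M; squaring and s² ≤ 4l give c = 1/64.

module Submission where

open import Defs
open import Algebra.Bundles using (CommutativeMonoid; CommutativeSemiring)
open import Data.Fin as Fin using (Fin; punchIn)
open import Data.Fin.Properties using (punchInᵢ≢i)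
import Data.Integer.Properties
open import Data.List using (List; []; _∷_; map; concatMap; length; _++_; tabulate; filter)
open import Data.List.Membership.Propositional using (_∈_)
open import Data.List.Membership.Propositional.Properties using (∈-filter⁻)
open import Data.List.Relation.Unary.Any using (here)
open import Data.Nat using (ℕ; zero; suc; _<_)
import Data.Nat.Properties
open import Data.Product using (∃-syntax; _×_; _,_)
open import Function using (_∘_; id)
open import Relation.Binary.Definitions using (DecidableEquality)
open import Relation.Binary.PropositionalEquality as ≡ using (_≡_; _≢_)
open import Relation.Unary using (Decidable)

module ListSum {c ℓ} (R : CommutativeSemiring c ℓ) where

  open CommutativeSemiring R
  open import Algebra.Properties.CommutativeSemigroup +-commutativeSemigroup using (interchange)
  open import Algebra.Properties.Monoid.Sum +-monoid public using (sum)
  open import Relation.Binary.Reasoning.Setoid setoid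

  private variable A B : Set

  ∑ : (A → Carrier) → List A → Carrier
  ∑ h []       = 0#
  ∑ h (x ∷ xs) = h x + ∑ h xs

  ∑-cong : {g h : A → Carrier} → (∀ x → g x ≈ h x) → ∀ xs → ∑ g xs ≈ ∑ h xs
  ∑-cong g≈h []       = refl
  ∑-cong g≈h (x ∷ xs) = +-cong (g≈h x) (∑-cong g≈h xs)

  ∑-++ : ∀ (h : A → Carrier) xs ys → ∑ h (xs ++ ys) ≈ ∑ h xs + ∑ h ys
  ∑-++ h []       ys = sym (+-identityˡ _)
  ∑-++ h (x ∷ xs) ys = trans (+-congˡ (∑-++ h xs ys)) (sym (+-assoc _ _ _))

  ∑-map : ∀ (h : B → Carrier) (g : A → B) xs → ∑ h (map g xs) ≈ ∑ (h ∘ g) xs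
  ∑-map h g []       = refl
  ∑-map h g (x ∷ xs) = +-congˡ (∑-map h g xs)

  ∑-concatMap : ∀ (h : B → Carrier) (g : A → List B) xs →
                ∑ h (concatMap g xs) ≈ ∑ (λ x → ∑ h (g x)) xs
  ∑-concatMap h g []       = refl
  ∑-concatMap h g (x ∷ xs) = trans (∑-++ h (g x) _) (+-congˡ (∑-concatMap h g xs))

  *-distribˡ-∑ : ∀ a (h : A → Carrier) xs → a * ∑ h xs ≈ ∑ (λ x → a * h x) xs
  *-distribˡ-∑ a h []       = zeroʳ a
  *-distribˡ-∑ a h (x ∷ xs) = trans (distribˡ a _ _) (+-congˡ (*-distribˡ-∑ a h xs))

  *-distribʳ-∑ : ∀ a (h : A → Carrier) xs → ∑ h xs * a ≈ ∑ (λ x → h x * a) xs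
  *-distribʳ-∑ a h []       = zeroˡ a
  *-distribʳ-∑ a h (x ∷ xs) = trans (distribʳ a _ _) (+-congˡ (*-distribʳ-∑ a h xs))

  ∑-distrib-+ : ∀ (g h : A → Carrier) xs → ∑ (λ x → g x + h x) xs ≈ ∑ g xs + ∑ h xs
  ∑-distrib-+ g h []       = sym (+-identityˡ 0#)
  ∑-distrib-+ g h (x ∷ xs) = trans (+-congˡ (∑-distrib-+ g h xs)) (interchange _ _ _ _)

  ∑-zero : ∀ (xs : List A) → ∑ (λ _ → 0#) xs ≈ 0#
  ∑-zero []       = refl
  ∑-zero (x ∷ xs) = trans (+-identityˡ _) (∑-zero xs)

  ∑-comm : ∀ (g : A → B → Carrier) xs ys →
           ∑ (λ x → ∑ (g x) ys) xs ≈ ∑ (λ y → ∑ (λ x → g x y) xs) ys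
  ∑-comm g []       ys = sym (∑-zero ys)
  ∑-comm g (x ∷ xs) ys = begin
    ∑ (g x) ys + ∑ (λ x′ → ∑ (g x′) ys) xs        ≈⟨ +-congˡ (∑-comm g xs ys) ⟩
    ∑ (g x) ys + ∑ (λ y → ∑ (λ x′ → g x′ y) xs) ys ≈⟨ ∑-distrib-+ (g x) _ ys ⟨
    ∑ (λ y → g x y + ∑ (λ x′ → g x′ y) xs) ys      ∎

  ∑-*-∑ : ∀ (g : A → Carrier) (h : B → Carrier) xs ys →
          ∑ g xs * ∑ h ys ≈ ∑ (λ x → ∑ (λ y → g x * h y) ys) xs
  ∑-*-∑ g h xs ys =
    trans (*-distribʳ-∑ (∑ h ys) g xs) (∑-cong (λ x → *-distribˡ-∑ (g x) h ys) xs)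

  ∑-tabulate : ∀ {n} (h : A → Carrier) (g : Fin n → A) → ∑ h (tabulate g) ≈ sum (h ∘ g)
  ∑-tabulate {n = zero}  h g = refl
  ∑-tabulate {n = suc n} h g = +-congˡ (∑-tabulate h (g ∘ Fin.suc))

module _ {a ℓ} (M : CommutativeMonoid a ℓ) where

  open CommutativeMonoid M
  open import Algebra.Properties.CommutativeMonoid.Sum M
    using (sum; sum-remove; sum-cong-≋; sum-replicate-zero)
  open import Relation.Binary.Reasoning.Setoid setoid

  sum-supported-at : ∀ {n} (t : Fin n → Carrier) i →
                     (∀ j → j ≢ i → t j ≈ ε) → sum t ≈ t i
  sum-supported-at {suc n} t i t≈ε = begin
    sum t                     ≈⟨ sum-remove {i = i} t ⟩
    t i ∙ sum (t ∘ punchIn i) ≈⟨ ∙-congˡ (sum-cong-≋ {n} (λ j → t≈ε _ (punchInᵢ≢i i j))) ⟩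
    t i ∙ sum {n} (λ _ → ε)   ≈⟨ ∙-congˡ (sum-replicate-zero n) ⟩
    t i ∙ ε                   ≈⟨ identityʳ (t i) ⟩
    t i                       ∎

module _ {A : Set} {P : A → Set} (P? : Decidable P) where

  ∃-∈-filter : ∀ xs → 0 < length (filter P? xs) → ∃[ x ] x ∈ xs × P x
  ∃-∈-filter xs 0<len with filter P? xs in eq
  ... | y ∷ _ = y , ∈-filter⁻ P? {xs = xs} (≡.subst (y ∈_) (≡.sym eq) (here ≡.refl))

module ℕ∑ = ListSum Data.Nat.Properties.+-*-commutativeSemiring
module ℤ∑ = ListSum Data.Integer.Properties.+-*-commutativeSemiring

module SecondMoment where

  open import Data.Bool using (Bool; true; false; if_then_else_)
  open import Data.Integer using (ℤ; +_; _+_; _*_)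
  import Data.Integer.Properties as ℤ
  open import Data.List using (allFin)
  open import Data.List.Properties using (length-tabulate)
  open import Data.Vec using ([]; _∷_; head; tail; lookup; insertAt)
  open import Data.Vec.Properties using (insertAt-lookup; ≡-dec)
  open import Relation.Binary.PropositionalEquality
    using (refl; sym; trans; cong; cong₂; module ≡-Reasoning)
  open import Relation.Nullary using (does)
  open import Relation.Nullary.Decidable using (dec-true; dec-false)
  open ℤ∑
  open import Algebra.Properties.CommutativeMonoid.Sum ℤ.*-1-commutativeMonoid using ()
    renaming ( sum to ∏; sum-cong-≗ to ∏-cong; sum-remove to ∏-remove
             ; sum-replicate-zero to ∏-replicate-one; ∑-distrib-+ to ∏-distrib-*)
  open ≡-Reasoning

  ∑-allFuns : ∀ {X : Set} n (xs : List X) (w : Fin n → X → ℤ) →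
              ∑ (λ g → ∏ (λ k → w k (g k))) (allFuns n xs) ≡ ∏ (λ k → ∑ (w k) xs)
  ∑-allFuns zero    xs w = refl
  ∑-allFuns (suc n) xs w = begin
    ∑ (λ g → ∏ (λ k → w k (g k))) (allFuns (suc n) xs)
      ≡⟨ ∑-concatMap _ _ xs ⟩
    ∑ (λ x → ∑ (λ g → ∏ (λ k → w k (g k))) (map _ (allFuns n xs))) xs
      ≡⟨ ∑-cong (λ x → ∑-map _ _ (allFuns n xs)) xs ⟩
    ∑ (λ x → ∑ (λ g → w Fin.zero x * ∏ (λ k → w (Fin.suc k) (g k))) (allFuns n xs)) xs
      ≡⟨ ∑-cong (λ x → sym (*-distribˡ-∑ (w Fin.zero x) _ (allFuns n xs))) xs ⟩
    ∑ (λ x → w Fin.zero x * ∑ (λ g → ∏ (λ k → w (Fin.suc k) (g k))) (allFuns n xs)) xs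
      ≡⟨ ∑-cong (λ x → cong (w Fin.zero x *_) (∑-allFuns n xs (w ∘ Fin.suc))) xs ⟩
    ∑ (λ x → w Fin.zero x * ∏ (λ k → ∑ (w (Fin.suc k)) xs)) xs
      ≡⟨ sym (*-distribʳ-∑ _ (w Fin.zero) xs) ⟩
    ∑ (w Fin.zero) xs * ∏ (λ k → ∑ (w (Fin.suc k)) xs) ∎

  ∏-zero : ∀ {n} (t : Fin n → ℤ) i → t i ≡ + 0 → ∏ t ≡ + 0
  ∏-zero {suc n} t i tᵢ≡0 = begin
    ∏ t                     ≡⟨ ∏-remove {i = i} t ⟩
    t i * ∏ (t ∘ punchIn i) ≡⟨ cong (_* ∏ (t ∘ punchIn i)) tᵢ≡0 ⟩
    + 0                     ∎

  ∏ˢ : ∀ f l → (Site f l → ℤ) → ℤ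
  ∏ˢ zero    l w = w []
  ∏ˢ (suc f) l w = ∏ (λ a → ∏ˢ f l (λ v → w (a ∷ v)))

  ∏ˢ-distrib-* : ∀ f l (u w : Site f l → ℤ) →
                 ∏ˢ f l (λ p → u p * w p) ≡ ∏ˢ f l u * ∏ˢ f l w
  ∏ˢ-distrib-* zero    l u w = refl
  ∏ˢ-distrib-* (suc f) l u w =
    trans (∏-cong {l} (λ a → ∏ˢ-distrib-* f l (u ∘ (a ∷_)) (w ∘ (a ∷_))))
          (∏-distrib-* {l} _ _)

  ∏ˢ-zero : ∀ f l (w : Site f l → ℤ) p → w p ≡ + 0 → ∏ˢ f l w ≡ + 0
  ∏ˢ-zero zero    l w []      wₚ≡0 = wₚ≡0
  ∏ˢ-zero (suc f) l w (a ∷ p) wₚ≡0 = ∏-zero _ a (∏ˢ-zero f l _ p wₚ≡0)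

  ∏ˢ-one : ∀ f l (w : Site f l → ℤ) → (∀ p → w p ≡ + 1) → ∏ˢ f l w ≡ + 1
  ∏ˢ-one zero    l w w≡1 = w≡1 []
  ∏ˢ-one (suc f) l w w≡1 =
    trans (∏-cong {l} (λ a → ∏ˢ-one f l _ (λ v → w≡1 (a ∷ v)))) (∏-replicate-one l)

  ∏ˢ-supported-at : ∀ f l (w : Site f l → ℤ) p →
                    (∀ q → q ≢ p → w q ≡ + 1) → ∏ˢ f l w ≡ w p
  ∏ˢ-supported-at zero    l w []      w≡1 = refl
  ∏ˢ-supported-at (suc f) l w (a ∷ p) w≡1 = trans
    (sum-supported-at ℤ.*-1-commutativeMonoid _ a
      (λ b b≢a → ∏ˢ-one f l _ (λ v → w≡1 (b ∷ v) (b≢a ∘ cong head))))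
    (∏ˢ-supported-at f l _ p (λ q q≢p → w≡1 (a ∷ q) (q≢p ∘ cong tail)))

  ∑-allSiteFuns : ∀ {X : Set} f l (xs : List X) (w : Site f l → X → ℤ) →
                  ∑ (λ S → ∏ˢ f l (λ p → w p (S p))) (allSiteFuns f l xs)
                  ≡ ∏ˢ f l (λ p → ∑ (w p) xs)
  ∑-allSiteFuns zero    l xs w = ∑-map _ _ xs
  ∑-allSiteFuns (suc f) l xs w = begin
    ∑ (λ S → ∏ˢ (suc f) l (λ p → w p (S p))) (allSiteFuns (suc f) l xs)
      ≡⟨ ∑-map _ _ (allFuns l (allSiteFuns f l xs)) ⟩
    ∑ (λ g → ∏ (λ a → ∏ˢ f l (λ v → w (a ∷ v) (g a v)))) (allFuns l (allSiteFuns f l xs))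
      ≡⟨ ∑-allFuns l _ (λ a T → ∏ˢ f l (λ v → w (a ∷ v) (T v))) ⟩
    ∏ (λ a → ∑ (λ T → ∏ˢ f l (λ v → w (a ∷ v) (T v))) (allSiteFuns f l xs))
      ≡⟨ ∏-cong {l} (λ a → ∑-allSiteFuns f l xs (λ v → w (a ∷ v))) ⟩
    ∏ˢ (suc f) l (λ p → ∑ (w p) xs) ∎

  _≟ˢ_ : ∀ {f l} → DecidableEquality (Site f l)
  _≟ˢ_ = ≡-dec Fin._≟_

  spinAt : ∀ {f l} → Site f l → Site f l → Bool → ℤ
  spinAt p q x = if does (q ≟ˢ p) then spin x else + 1

  ∏ˢ-spinAt : ∀ f l (S : Assignment f l) p → ∏ˢ f l (λ q → spinAt p q (S q)) ≡ spin (S p)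
  ∏ˢ-spinAt f l S p = begin
    ∏ˢ f l (λ q → spinAt p q (S q)) ≡⟨ ∏ˢ-supported-at f l _ p off-p ⟩
    spinAt p p (S p)
      ≡⟨ cong (λ b → if b then spin (S p) else + 1) (dec-true (p ≟ˢ p) refl) ⟩
    spin (S p)                      ∎
    where
    off-p : ∀ q → q ≢ p → spinAt p q (S q) ≡ + 1
    off-p q q≢p = cong (λ b → if b then spin (S q) else + 1) (dec-false (q ≟ˢ p) q≢p)

  -- S i · S j = ∏_q w q (S q), so the sum over S factorizes over the sites and the factor at i is
  -- spin true + spin false = 0.
  ∑-spin-spin-≢ : ∀ f l (i j : Site f l) → i ≢ j →
                  ∑ (λ S → spin (S i) * spin (S j)) (allAssignments f l) ≡ + 0
  ∑-spin-spin-≢ f l i j i≢j = begin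
    ∑ (λ S → spin (S i) * spin (S j)) (allAssignments f l)
      ≡⟨ ∑-cong (λ S → sym (as-product S)) (allAssignments f l) ⟩
    ∑ (λ S → ∏ˢ f l (λ q → w q (S q))) (allAssignments f l)
      ≡⟨ ∑-allSiteFuns f l (true ∷ false ∷ []) w ⟩
    ∏ˢ f l (λ q → ∑ (w q) (true ∷ false ∷ []))
      ≡⟨ ∏ˢ-zero f l _ i vanishes-at-i ⟩
    + 0 ∎
    where
    w : Site f l → Bool → ℤ
    w q x = spinAt i q x * spinAt j q x
    as-product : ∀ S → ∏ˢ f l (λ q → w q (S q)) ≡ spin (S i) * spin (S j)
    as-product S = trans (∏ˢ-distrib-* f l _ _) (cong₂ _*_ (∏ˢ-spinAt f l S i) (∏ˢ-spinAt f l S j))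
    vanishes-at-i : ∑ (w i) (true ∷ false ∷ []) ≡ + 0
    vanishes-at-i rewrite dec-true (i ≟ˢ i) refl | dec-false (i ≟ˢ j) i≢j = refl

  sumℤ-map : ∀ {A : Set} (h : A → ℤ) xs → sumℤ (map h xs) ≡ ∑ h xs
  sumℤ-map h []       = refl
  sumℤ-map h (x ∷ xs) = cong (_+_ (h x)) (sumℤ-map h xs)

  ∑-const : ∀ {A : Set} a (xs : List A) → ∑ (λ _ → a) xs ≡ + length xs * a
  ∑-const a []       = refl
  ∑-const a (x ∷ xs) = begin
    a + ∑ (λ _ → a) xs        ≡⟨ cong (_+_ a) (∑-const a xs) ⟩
    a + + length xs * a       ≡⟨ cong (_+ + length xs * a) (ℤ.*-identityˡ a) ⟨
    + 1 * a + + length xs * a ≡⟨ ℤ.*-distribʳ-+ a (+ 1) (+ length xs) ⟨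
    + length (x ∷ xs) * a     ∎

  spin*spin : ∀ b → spin b * spin b ≡ + 1
  spin*spin true  = refl
  spin*spin false = refl

  colSite-injective : ∀ {f l} (C : Column f l) {x y} → colSite C x ≡ colSite C y → x ≡ y
  colSite-injective {suc g} (b , v) {x} {y} eq = begin
    x                         ≡⟨ insertAt-lookup v b x ⟨
    lookup (insertAt v b x) b ≡⟨ cong (λ p → lookup p b) eq ⟩
    lookup (insertAt v b y) b ≡⟨ insertAt-lookup v b y ⟩
    y                         ∎

  ∑-colSum² : ∀ f l (C : Column f l) →
              ∑ (λ S → colSum S C * colSum S C) (allAssignments f l)
              ≡ + l * + length (allAssignments f l)
  ∑-colSum² f l C = begin
    ∑ (λ S → colSum S C * colSum S C) A
      ≡⟨ ∑-cong (λ S → cong₂ _*_ (sumℤ-map (s S) (allFin l)) (sumℤ-map (s S) (allFin l))) A ⟩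
    ∑ (λ S → ∑ (s S) (allFin l) * ∑ (s S) (allFin l)) A
      ≡⟨ ∑-cong (λ S → ∑-*-∑ (s S) (s S) (allFin l) (allFin l)) A ⟩
    ∑ (λ S → ∑ (λ x → ∑ (λ y → s S x * s S y) (allFin l)) (allFin l)) A
      ≡⟨ ∑-comm _ A (allFin l) ⟩
    ∑ (λ x → ∑ (λ S → ∑ (λ y → s S x * s S y) (allFin l)) A) (allFin l)
      ≡⟨ ∑-cong (λ x → ∑-comm _ A (allFin l)) (allFin l) ⟩
    ∑ (λ x → ∑ (λ y → ∑ (λ S → s S x * s S y) A) (allFin l)) (allFin l)
      ≡⟨ ∑-cong diagonal (allFin l) ⟩
    ∑ (λ _ → + length A) (allFin l)
      ≡⟨ ∑-const _ (allFin l) ⟩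
    + length (allFin l) * + length A
      ≡⟨ cong (λ n → + n * + length A) (length-tabulate {n = l} id) ⟩
    + l * + length A ∎
    where
    A : List (Assignment f l)
    A = allAssignments f l
    s : Assignment f l → Fin l → ℤ
    s S x = spin (S (colSite C x))
    diagonal : ∀ x → ∑ (λ y → ∑ (λ S → s S x * s S y) A) (allFin l) ≡ + length A
    diagonal x = begin
      ∑ (λ y → ∑ (λ S → s S x * s S y) A) (allFin l)
        ≡⟨ ∑-tabulate {n = l} _ id ⟩
      sum {l} (λ y → ∑ (λ S → s S x * s S y) A)
        ≡⟨ sum-supported-at ℤ.+-0-commutativeMonoid _ x
             (λ y y≢x → ∑-spin-spin-≢ f l _ _ (y≢x ∘ sym ∘ colSite-injective C)) ⟩
      ∑ (λ S → s S x * s S x) A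
        ≡⟨ ∑-cong (λ S → spin*spin (S (colSite C x))) A ⟩
      ∑ (λ _ → + 1) A
        ≡⟨ ∑-const (+ 1) A ⟩
      + length A * + 1
        ≡⟨ ℤ.*-identityʳ _ ⟩
      + length A ∎

  ∑∑-colSum² : ∀ f l →
               ∑ (λ S → ∑ (λ C → colSum S C * colSum S C) (allColumns f l)) (allAssignments f l)
               ≡ + length (allColumns f l) * (+ l * + length (allAssignments f l))
  ∑∑-colSum² f l = begin
    ∑ (λ S → ∑ (λ C → colSum S C * colSum S C) (allColumns f l)) (allAssignments f l)
      ≡⟨ ∑-comm _ (allAssignments f l) (allColumns f l) ⟩
    ∑ (λ C → ∑ (λ S → colSum S C * colSum S C) (allAssignments f l)) (allColumns f l)
      ≡⟨ ∑-cong (∑-colSum² f l) (allColumns f l) ⟩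
    ∑ (λ _ → + l * + length (allAssignments f l)) (allColumns f l)
      ≡⟨ ∑-const _ (allColumns f l) ⟩
    + length (allColumns f l) * (+ l * + length (allAssignments f l)) ∎

module Enumerations where

  open import Data.Nat using (_+_; _*_; _^_)
  open import Data.Nat.Properties using (*-identityʳ; *-comm; ^-*-assoc)
  open import Data.List using (allFin)
  open import Data.List.Properties using (length-map; length-++; length-tabulate)
  open import Data.Bool using (true; false)
  open import Data.List.Relation.Unary.All as All using (All; []; _∷_)
  open import Relation.Binary.PropositionalEquality
    using (refl; sym; trans; cong; cong₂; module ≡-Reasoning)
  open ≡-Reasoning

  length-concatMap-const : ∀ {A B : Set} (g : A → List B) c xs →
                           All (λ x → length (g x) ≡ c) xs →
                           length (concatMap g xs) ≡ length xs * c
  length-concatMap-const g c []       []            = refl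
  length-concatMap-const g c (x ∷ xs) (|gx| ∷ |g|) =
    trans (length-++ (g x)) (cong₂ _+_ |gx| (length-concatMap-const g c xs |g|))

  length-allFuns : ∀ {X : Set} n (xs : List X) → length (allFuns n xs) ≡ length xs ^ n
  length-allFuns zero    xs = refl
  length-allFuns (suc n) xs = length-concatMap-const _ _ xs
    (All.universal (λ x → trans (length-map _ (allFuns n xs)) (length-allFuns n xs)) xs)

  length-allVecs : ∀ {X : Set} n (xs : List X) → length (allVecs n xs) ≡ length xs ^ n
  length-allVecs zero    xs = refl
  length-allVecs (suc n) xs = length-concatMap-const _ _ xs
    (All.universal (λ x → trans (length-map _ (allVecs n xs)) (length-allVecs n xs)) xs)

  length-allSiteFuns : ∀ {X : Set} f l (xs : List X) → length (allSiteFuns f l xs) ≡ length xs ^ (l ^ f)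
  length-allSiteFuns zero    l xs = trans (length-map _ xs) (sym (*-identityʳ (length xs)))
  length-allSiteFuns (suc f) l xs = begin
    length (allSiteFuns (suc f) l xs)       ≡⟨ length-map _ (allFuns l (allSiteFuns f l xs)) ⟩
    length (allFuns l (allSiteFuns f l xs)) ≡⟨ length-allFuns l (allSiteFuns f l xs) ⟩
    length (allSiteFuns f l xs) ^ l         ≡⟨ cong (_^ l) (length-allSiteFuns f l xs) ⟩
    (length xs ^ (l ^ f)) ^ l               ≡⟨ ^-*-assoc (length xs) (l ^ f) l ⟩
    length xs ^ (l ^ f * l)                 ≡⟨ cong (length xs ^_) (*-comm (l ^ f) l) ⟩
    length xs ^ (l * l ^ f)                 ∎

  length-allAssignments : ∀ f l → length (allAssignments f l) ≡ 2 ^ (l ^ f)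
  length-allAssignments f l = length-allSiteFuns f l (true ∷ false ∷ [])

  length-allColumns : ∀ g l → length (allColumns (suc g) l) ≡ suc g * l ^ g
  length-allColumns g l = begin
    length (allColumns (suc g) l)
      ≡⟨ length-concatMap-const (λ b → map (b ,_) (allVecs g (allFin l))) (l ^ g) (allFin (suc g))
           (All.universal length-block _) ⟩
    length (allFin (suc g)) * l ^ g ≡⟨ cong (_* l ^ g) (length-tabulate {n = suc g} id) ⟩
    suc g * l ^ g                   ∎
    where
    length-block : ∀ b → length (map (b ,_) (allVecs g (allFin l))) ≡ l ^ g
    length-block b = begin
      length (map (b ,_) (allVecs g (allFin l))) ≡⟨ length-map _ (allVecs g (allFin l)) ⟩
      length (allVecs g (allFin l))              ≡⟨ length-allVecs g (allFin l) ⟩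
      length (allFin l) ^ g                      ≡⟨ cong (_^ g) (length-tabulate {n = l} id) ⟩
      l ^ g                                      ∎

module Energy where

  open import Data.Nat using (_+_; _*_; _≤_; _<_; z≤n)
  import Data.Nat.Properties as ℕ
  open import Data.Integer as ℤ using (ℤ; +_; -[1+_]; ∣_∣; +≤+)
  import Data.Integer.Properties as ℤ
  open import Data.List.Properties using (filter-≐)
  open import Data.List.Relation.Unary.All as All using (All; []; _∷_; all?)
  open import Data.List.Relation.Unary.All.Properties using (map⁻)
  open import Relation.Binary.PropositionalEquality
    using (refl; sym; trans; cong; cong₂; subst₂; module ≡-Reasoning)

  private variable A : Set

  ‖_‖² : List ℤ → ℕ
  ‖ xs ‖² = ℕ∑.∑ (λ x → ∣ x ∣ * ∣ x ∣) xs

  +‖‖² : ∀ (h : A → ℤ) xs → + ‖ map h xs ‖² ≡ ℤ∑.∑ (λ x → h x ℤ.* h x) xs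
  +‖‖² h []       = refl
  +‖‖² h (x ∷ xs) =
    trans (ℤ.pos-+ _ ‖ map h xs ‖²) (cong₂ ℤ._+_ (+∣i∣*∣i∣ (h x)) (+‖‖² h xs))
    where
    +∣i∣*∣i∣ : ∀ i → + (∣ i ∣ * ∣ i ∣) ≡ i ℤ.* i
    +∣i∣*∣i∣ (+ n)    = sym (ℤ.+◃n≡+n (n * n))
    +∣i∣*∣i∣ -[1+ n ] = sym (ℤ.+◃n≡+n _)

  ‖‖²≡0⇒ : ∀ xs → ‖ xs ‖² ≡ 0 → All (_≡ + 0) xs
  ‖‖²≡0⇒ []       _  = []
  ‖‖²≡0⇒ (x ∷ xs) eq =
    ℤ.∣i∣≡0⇒i≡0 (m*m≡0⇒m≡0 ∣ x ∣ (ℕ.m+n≡0⇒m≡0 _ eq))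
    ∷ ‖‖²≡0⇒ xs (ℕ.m+n≡0⇒n≡0 _ eq)
    where
    m*m≡0⇒m≡0 : ∀ m → m * m ≡ 0 → m ≡ 0
    m*m≡0⇒m≡0 zero _ = refl

  module _ (f l : ℕ) (M : Column f l → ℤ) where

    mismatch : Assignment f l → List ℤ
    mismatch S = map (λ C → colSum S C ℤ.- M C) (allColumns f l)

    H≡‖mismatch‖² : ∀ S → H f l M S ≡ + ‖ mismatch S ‖²
    H≡‖mismatch‖² S =
      trans (SecondMoment.sumℤ-map _ (allColumns f l)) (sym (+‖‖² _ (allColumns f l)))

    ‖mismatch‖²≡0⇒ZeroEnergy : ∀ S → ‖ mismatch S ‖² ≡ 0 → ZeroEnergy f l M S
    ‖mismatch‖²≡0⇒ZeroEnergy S eq =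
      All.map (λ {C} → ℤ.i-j≡0⇒i≡j (colSum S C) (M C)) (map⁻ (‖‖²≡0⇒ (mismatch S) eq))

    ZeroEnergy⇒‖mismatch‖²≡0 : ∀ S → ZeroEnergy f l M S → ‖ mismatch S ‖² ≡ 0
    ZeroEnergy⇒‖mismatch‖²≡0 S = go (allColumns f l)
      where
      go : ∀ Cs → All (λ C → colSum S C ≡ M C) Cs →
           ‖ map (λ C → colSum S C ℤ.- M C) Cs ‖² ≡ 0
      go []       []           = refl
      go (C ∷ Cs) (eq ∷ eqs) rewrite eq | ℤ.+-inverseʳ (M C) = go Cs eqs

    zeroEnergy? : Decidable (ZeroEnergy f l M)
    zeroEnergy? S = all? (λ C → colSum S C ℤ.≟ M C) (allColumns f l)

    globalMin? : Decidable (GlobalMin f l M)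
    globalMin? S = all? (λ S′ → H f l M S ℤ.≤? H f l M S′) (allAssignments f l)

    nGM≡nZE : 0 < nZE f l M → nGM f l M ≡ nZE f l M
    nGM≡nZE 0<nZE with ∃-∈-filter zeroEnergy? (allAssignments f l) 0<nZE
    ... | S₀ , S₀∈ , zeS₀ = cong length
      (filter-≐ globalMin? zeroEnergy? ((λ {S} → GM⇒ZE S) , (λ {S} → ZE⇒GM S))
        (allAssignments f l))
      where
      H≡0 : ∀ S → ZeroEnergy f l M S → H f l M S ≡ + 0
      H≡0 S ze = trans (H≡‖mismatch‖² S) (cong +_ (ZeroEnergy⇒‖mismatch‖²≡0 S ze))
      GM⇒ZE : ∀ S → GlobalMin f l M S → ZeroEnergy f l M S
      GM⇒ZE S gm = ‖mismatch‖²≡0⇒ZeroEnergy S (ℕ.n≤0⇒n≡0 (ℤ.drop‿+≤+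
        (subst₂ ℤ._≤_ (H≡‖mismatch‖² S) (H≡0 S₀ zeS₀) (All.lookup gm S₀∈))))
      ZE⇒GM : ∀ S → ZeroEnergy f l M S → GlobalMin f l M S
      ZE⇒GM S ze = All.universal
        (λ S′ → subst₂ ℤ._≤_ (sym (H≡0 S ze)) (sym (H≡‖mismatch‖² S′)) (+≤+ z≤n)) _

  +∑ : ∀ (h : A → ℕ) xs → + ℕ∑.∑ h xs ≡ ℤ∑.∑ (λ x → + h x) xs
  +∑ h []       = refl
  +∑ h (x ∷ xs) = trans (ℤ.pos-+ (h x) (ℕ∑.∑ h xs)) (cong (ℤ._+_ (+ h x)) (+∑ h xs))

  colSums : ∀ {f l} → Assignment f l → List ℤ
  colSums {f} {l} S = map (colSum S) (allColumns f l)

  ∑‖colSums‖² : ∀ f l → ℕ∑.∑ (λ S → ‖ colSums S ‖²) (allAssignments f l)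
                       ≡ length (allColumns f l) * (l * length (allAssignments f l))
  ∑‖colSums‖² f l = ℤ.+-injective (begin
    + ℕ∑.∑ (λ S → ‖ colSums S ‖²) Ss
      ≡⟨ +∑ _ Ss ⟩
    ℤ∑.∑ (λ S → + ‖ colSums S ‖²) Ss
      ≡⟨ ℤ∑.∑-cong (λ S → +‖‖² (colSum S) (allColumns f l)) Ss ⟩
    ℤ∑.∑ (λ S → ℤ∑.∑ (λ C → colSum S C ℤ.* colSum S C) (allColumns f l)) Ss
      ≡⟨ SecondMoment.∑∑-colSum² f l ⟩
    + n ℤ.* (+ l ℤ.* + length Ss)
      ≡⟨ cong (ℤ._*_ (+ n)) (ℤ.pos-* l (length Ss)) ⟨
    + n ℤ.* + (l * length Ss)
      ≡⟨ ℤ.pos-* n (l * length Ss) ⟨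
    + (n * (l * length Ss)) ∎)
    where
    open ≡-Reasoning
    Ss : List (Assignment f l)
    Ss = allAssignments f l
    n : ℕ
    n = length (allColumns f l)

module Counting where

  open import Data.Bool using (true; false; if_then_else_)
  open import Data.Nat using (_+_; _*_; _≤_; _<_; _≤?_; z≤n; s≤s)
  import Data.Nat.Properties as ℕ
  open import Data.Nat.Tactic.RingSolver using (solve-∀)
  open import Data.List.Extrema.Nat using (argmax; f[⊥]≤f[argmax]; f[xs]≤f[argmax])
  open import Data.List.Membership.Propositional using (_∈_)
  open import Data.List.Relation.Unary.All using (All; []; _∷_)
  open import Data.List.Relation.Unary.Any using (here; there)
  open import Relation.Binary.PropositionalEquality using (refl; sym; trans; cong; subst)
  open import Relation.Nullary using (does; yes; no; contradiction)
  open import Relation.Nullary.Decidable using (dec-true)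
  open import Relation.Unary.Properties using (∁?)

  private variable A : Set

  ∑-mono-≤ : ∀ {g h : A → ℕ} → (∀ x → g x ≤ h x) → ∀ xs → ℕ∑.∑ g xs ≤ ℕ∑.∑ h xs
  ∑-mono-≤ g≤h []       = z≤n
  ∑-mono-≤ g≤h (x ∷ xs) = ℕ.+-mono-≤ (g≤h x) (∑-mono-≤ g≤h xs)

  ∑≤length* : ∀ (g : A → ℕ) {B} xs → All (λ x → g x ≤ B) xs →
              ℕ∑.∑ g xs ≤ length xs * B
  ∑≤length* g []       []           = z≤n
  ∑≤length* g (x ∷ xs) (gx≤B ∷ g≤B) = ℕ.+-mono-≤ gx≤B (∑≤length* g xs g≤B)

  module _ {P : A → Set} (P? : Decidable P) where

    markov : ∀ (g : A → ℕ) c → (∀ x → P x → c ≤ g x) →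
             ∀ xs → length (filter P? xs) * c ≤ ℕ∑.∑ g xs
    markov g c c≤g []       = z≤n
    markov g c c≤g (x ∷ xs) with P? x
    ... | yes px = ℕ.+-mono-≤ (c≤g x px) (markov g c c≤g xs)
    ... | no  _  = ℕ.≤-trans (markov g c c≤g xs) (ℕ.m≤n+m _ (g x))

    length-filter+length-filter-∁ : ∀ xs →
      length (filter P? xs) + length (filter (∁? P?) xs) ≡ length xs
    length-filter+length-filter-∁ []       = refl
    length-filter+length-filter-∁ (x ∷ xs) with P? x
    ... | yes _ = cong suc (length-filter+length-filter-∁ xs)
    ... | no  _ = trans (ℕ.+-suc _ _) (cong suc (length-filter+length-filter-∁ xs))

  half-≤-twice-mean : ∀ (g : A → ℕ) X xs → ℕ∑.∑ g xs ≤ X * length xs →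
                      length xs ≤ 2 * length (filter (λ x → g x ≤? 2 * X) xs)
  half-≤-twice-mean g X xs ∑g≤ = begin
    length xs   ≡⟨ partition ⟨
    good + bad  ≤⟨ ℕ.+-monoʳ-≤ good bad≤good ⟩
    good + good ≡⟨ cong (good +_) (ℕ.+-identityʳ good) ⟨
    2 * good    ∎
    where
    open ℕ.≤-Reasoning
    P? : Decidable (λ x → g x ≤ 2 * X)
    P? x = g x ≤? 2 * X
    good bad : ℕ
    good = length (filter P? xs)
    bad  = length (filter (∁? P?) xs)
    partition : good + bad ≡ length xs
    partition = length-filter+length-filter-∁ P? xs
    bad-bound : bad * suc (2 * X) ≤ X * (good + bad)
    bad-bound = ℕ.≤-trans (markov (∁? P?) g _ (λ x → ℕ.≰⇒>) xs)
      (ℕ.≤-trans ∑g≤ (ℕ.≤-reflexive (cong (X *_) (sym partition))))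
    rearrange : ∀ X b → X * b + X * b + b ≡ b * suc (2 * X)
    rearrange = solve-∀
    bad≤good : bad ≤ good
    bad≤good with bad ℕ.≤? good
    ... | yes b≤g = b≤g
    ... | no  b≰g = contradiction bad-bound (ℕ.<⇒≱ (begin-strict
      X * (good + bad)        ≡⟨ ℕ.*-distribˡ-+ X good bad ⟩
      X * good + X * bad      ≤⟨ ℕ.+-monoˡ-≤ (X * bad) (ℕ.*-monoʳ-≤ X (ℕ.<⇒≤ good<bad)) ⟩
      X * bad + X * bad       <⟨ ℕ.m<m+n (X * bad + X * bad) (ℕ.≤-<-trans z≤n good<bad) ⟩
      X * bad + X * bad + bad ≡⟨ rearrange X bad ⟩
      bad * suc (2 * X)       ∎))
      where
      good<bad : good < bad
      good<bad = ℕ.≰⇒> b≰g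

  module _ {I K : Set} (key : I → K) (_≟_ : DecidableEquality K) where

    count : List I → K → ℕ
    count items k = length (filter (λ i → key i ≟ k) items)

    private
      hit : K → K → ℕ
      hit k k′ = if does (k ≟ k′) then 1 else 0

      count-∷ : ∀ i items k → count (i ∷ items) k ≡ hit (key i) k + count items k
      count-∷ i items k with does (key i ≟ k)
      ... | true  = refl
      ... | false = refl

      1≤∑hit : ∀ {k ks} → k ∈ ks → 1 ≤ ℕ∑.∑ (hit k) ks
      1≤∑hit {k} (here refl) rewrite dec-true (k ≟ k) refl = s≤s z≤n
      1≤∑hit {k} {k′ ∷ _} (there k∈ks) =
        ℕ.≤-trans (1≤∑hit k∈ks) (ℕ.m≤n+m _ (hit k k′))

    length≤∑count : ∀ ks items → (∀ {i} → i ∈ items → key i ∈ ks) →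
                    length items ≤ ℕ∑.∑ (count items) ks
    length≤∑count ks []          _     = z≤n
    length≤∑count ks (i ∷ items) keys∈ = begin
      1 + length items
        ≤⟨ ℕ.+-mono-≤ (1≤∑hit (keys∈ (here refl)))
                      (length≤∑count ks items (keys∈ ∘ there)) ⟩
      ℕ∑.∑ (hit (key i)) ks + ℕ∑.∑ (count items) ks
        ≡⟨ ℕ∑.∑-distrib-+ (hit (key i)) (count items) ks ⟨
      ℕ∑.∑ (λ k → hit (key i) k + count items k) ks
        ≡⟨ ℕ∑.∑-cong (λ k → sym (count-∷ i items k)) ks ⟩
      ℕ∑.∑ (count (i ∷ items)) ks ∎
      where open ℕ.≤-Reasoning

    pigeonhole : ∀ ks items → (∀ {i} → i ∈ items → key i ∈ ks) → 0 < length items →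
                 ∃[ i ] length items ≤ length ks * count items (key i)
    pigeonhole []         (i ∷ _) keys∈ _ with () ← keys∈ (here refl)
    pigeonhole (k₀ ∷ ks′) items   keys∈ 0<len =
      at-key (∃-∈-filter (λ i → key i ≟ k*) items 0<count)
      where
      k* : K
      k* = argmax (count items) k₀ ks′
      items≤ : length items ≤ length (k₀ ∷ ks′) * count items k*
      items≤ = ℕ.≤-trans (length≤∑count (k₀ ∷ ks′) items keys∈)
        (∑≤length* (count items) (k₀ ∷ ks′)
          (f[⊥]≤f[argmax] {f = count items} k₀ ks′ ∷ f[xs]≤f[argmax] k₀ ks′))
      0<count : 0 < count items k*
      0<count = ℕ.≰⇒> (λ c≤0 → ℕ.<⇒≱ 0<len (ℕ.≤-trans items≤
        (ℕ.≤-trans (ℕ.*-monoʳ-≤ (length (k₀ ∷ ks′)) c≤0)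
                   (ℕ.≤-reflexive (ℕ.*-zeroʳ (length (k₀ ∷ ks′)))))))
      at-key : ∃[ i ] i ∈ items × key i ≡ k* →
               ∃[ i ] length items ≤ length (k₀ ∷ ks′) * count items (key i)
      at-key (i , _ , kᵢ≡k*) =
        i , subst (λ k → length items ≤ length (k₀ ∷ ks′) * count items k) (sym kᵢ≡k*) items≤

module IntegerPoints where

  open import Data.Nat using (_+_; _*_; _^_; _≤_; z≤n; s≤s; NonZero; _/_; _%_)
  import Data.Nat.Properties as ℕ
  open import Data.Nat.DivMod using (m≡m%n+[m/n]*n; m%n<n; m/n*n≤m)
  open import Data.Nat.Tactic.RingSolver using (solve-∀)
  open import Data.Integer as ℤ using (ℤ; +_; -[1+_]; ∣_∣)
  open import Data.List using (upTo)
  open import Data.List.Properties using (length-map; length-++; length-upTo)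
  open import Data.List.Membership.Propositional using (_∈_; lose)
  open import Data.List.Membership.Propositional.Properties
    using (∈-map⁺; ∈-++⁺ˡ; ∈-++⁺ʳ; ∈-concatMap⁺; ∈-upTo⁺)
  open import Data.List.Relation.Unary.All as All using (All; []; _∷_)
  open import Data.List.Relation.Unary.Any using (here)
  import Data.List.Relation.Unary.All.Properties as All
  open import Relation.Binary.PropositionalEquality
    using (refl; sym; trans; cong; cong₂; subst; module ≡-Reasoning)
  open Enumerations using (length-concatMap-const)
  open Energy using (‖_‖²)
  open Counting using (∑-mono-≤)

  bumpHead : List ℕ → List ℕ
  bumpHead []       = []
  bumpHead (t ∷ ts) = suc t ∷ ts

  -- The head is either 0, or positive and then decrementing it lowers the bound: hence 2^(n + A) lists.
  listsWithSum≤ : ℕ → ℕ → List (List ℕ)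
  listsWithSum≤ zero    A       = [] ∷ []
  listsWithSum≤ (suc n) zero    = map (0 ∷_) (listsWithSum≤ n zero)
  listsWithSum≤ (suc n) (suc A) =
    map (0 ∷_) (listsWithSum≤ n (suc A)) ++ map bumpHead (listsWithSum≤ (suc n) A)

  length-listsWithSum≤ : ∀ n A → length (listsWithSum≤ n A) ≤ 2 ^ (n + A)
  length-listsWithSum≤ zero    A       = ℕ.m^n>0 2 A
  length-listsWithSum≤ (suc n) zero    = begin
    length (map (0 ∷_) (listsWithSum≤ n zero)) ≡⟨ length-map _ (listsWithSum≤ n zero) ⟩
    length (listsWithSum≤ n zero)              ≤⟨ length-listsWithSum≤ n zero ⟩
    2 ^ (n + 0)                               ≤⟨ ℕ.m≤m+n _ _ ⟩
    2 ^ suc (n + 0)                           ∎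
    where open ℕ.≤-Reasoning
  length-listsWithSum≤ (suc n) (suc A) = begin
    length (map (0 ∷_) (listsWithSum≤ n (suc A)) ++ map bumpHead (listsWithSum≤ (suc n) A))
      ≡⟨ length-++ (map (0 ∷_) (listsWithSum≤ n (suc A))) ⟩
    length (map (0 ∷_) (listsWithSum≤ n (suc A))) + length (map bumpHead (listsWithSum≤ (suc n) A))
      ≡⟨ cong₂ _+_ (length-map _ (listsWithSum≤ n (suc A)))
                   (length-map _ (listsWithSum≤ (suc n) A)) ⟩
    length (listsWithSum≤ n (suc A)) + length (listsWithSum≤ (suc n) A)
      ≤⟨ ℕ.+-mono-≤ (length-listsWithSum≤ n (suc A)) (length-listsWithSum≤ (suc n) A) ⟩
    2 ^ (n + suc A) + 2 ^ (suc n + A)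
      ≡⟨ cong (λ m → 2 ^ m + 2 ^ (suc n + A)) (ℕ.+-suc n A) ⟩
    2 ^ (suc n + A) + 2 ^ (suc n + A)
      ≡⟨ cong (λ m → 2 ^ (suc n + A) + m) (ℕ.+-identityʳ _) ⟨
    2 ^ suc (suc n + A)
      ≡⟨ cong (2 ^_) (ℕ.+-suc (suc n) A) ⟨
    2 ^ (suc n + suc A) ∎
    where open ℕ.≤-Reasoning

  All-length-listsWithSum≤ : ∀ n A → All (λ ts → length ts ≡ n) (listsWithSum≤ n A)
  All-length-listsWithSum≤ zero    A       = refl ∷ []
  All-length-listsWithSum≤ (suc n) zero    =
    All.map⁺ (All.map (cong suc) (All-length-listsWithSum≤ n zero))
  All-length-listsWithSum≤ (suc n) (suc A) = All.++⁺
    (All.map⁺ (All.map (cong suc) (All-length-listsWithSum≤ n (suc A))))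
    (All.map⁺ (All.map (λ {ts} → trans (length-bumpHead ts)) (All-length-listsWithSum≤ (suc n) A)))
    where
    length-bumpHead : ∀ ts → length (bumpHead ts) ≡ length ts
    length-bumpHead []      = refl
    length-bumpHead (_ ∷ _) = refl

  ∈-listsWithSum≤ : ∀ n A ts → length ts ≡ n → ℕ∑.∑ id ts ≤ A →
                    ts ∈ listsWithSum≤ n A
  ∈-listsWithSum≤ zero    A       []           _   _ = here refl
  ∈-listsWithSum≤ (suc n) zero    (zero ∷ ts)  len ∑≤ =
    ∈-map⁺ (0 ∷_) (∈-listsWithSum≤ n zero ts (ℕ.suc-injective len) ∑≤)
  ∈-listsWithSum≤ (suc n) (suc A) (zero ∷ ts)  len ∑≤ =
    ∈-++⁺ˡ (∈-map⁺ (0 ∷_) (∈-listsWithSum≤ n (suc A) ts (ℕ.suc-injective len) ∑≤))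
  ∈-listsWithSum≤ (suc n) (suc A) (suc t ∷ ts) len (s≤s ∑≤) =
    ∈-++⁺ʳ (map (0 ∷_) (listsWithSum≤ n (suc A)))
      (∈-map⁺ bumpHead (∈-listsWithSum≤ (suc n) A (t ∷ ts) len ∑≤))

  module _ (s : ℕ) where

    -- Every x with ⌊|x|/s⌋ = t occurs (0 twice when t = 0); only membership and the length are used.
    withQuotient : ℕ → List ℤ
    withQuotient t = map (λ r → + (t * s + r)) (upTo s) ++ map (λ r → ℤ.- + (t * s + r)) (upTo s)

    withQuotients : List ℕ → List (List ℤ)
    withQuotients []       = [] ∷ []
    withQuotients (t ∷ ts) = concatMap (λ x → map (x ∷_) (withQuotients ts)) (withQuotient t)

    length-withQuotients : ∀ ts → length (withQuotients ts) ≡ (2 * s) ^ length ts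
    length-withQuotients []       = refl
    length-withQuotients (t ∷ ts) = begin
      length (withQuotients (t ∷ ts))
        ≡⟨ length-concatMap-const _ _ (withQuotient t) (All.universal length-block _) ⟩
      length (withQuotient t) * (2 * s) ^ length ts
        ≡⟨ cong (_* (2 * s) ^ length ts) length-withQuotient ⟩
      (2 * s) ^ length (t ∷ ts) ∎
      where
      open ≡-Reasoning
      length-block : ∀ x → length (map (x ∷_) (withQuotients ts)) ≡ (2 * s) ^ length ts
      length-block x = trans (length-map _ (withQuotients ts)) (length-withQuotients ts)
      length-half : ∀ (g : ℕ → ℤ) → length (map g (upTo s)) ≡ s
      length-half g = trans (length-map g (upTo s)) (length-upTo s)
      length-withQuotient : length (withQuotient t) ≡ 2 * s
      length-withQuotient = begin
        length (withQuotient t) ≡⟨ length-++ (map (λ r → + (t * s + r)) (upTo s)) ⟩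
        length (map (λ r → + (t * s + r)) (upTo s)) + length (map (λ r → ℤ.- + (t * s + r)) (upTo s))
          ≡⟨ cong₂ _+_ (length-half _) (length-half _) ⟩
        s + s                   ≡⟨ cong (_+_ s) (ℕ.+-identityʳ s) ⟨
        2 * s                   ∎

    keys : ℕ → ℕ → List (List ℤ)
    keys n A = concatMap withQuotients (listsWithSum≤ n A)

    length-keys : ∀ n A → length (keys n A) ≤ 2 ^ (n + A) * (2 * s) ^ n
    length-keys n A = begin
      length (keys n A)
        ≡⟨ length-concatMap-const withQuotients _ (listsWithSum≤ n A)
             (All.map (λ {ts} |ts|≡n → trans (length-withQuotients ts) (cong ((2 * s) ^_) |ts|≡n))
               (All-length-listsWithSum≤ n A)) ⟩
      length (listsWithSum≤ n A) * (2 * s) ^ n ≤⟨ ℕ.*-monoˡ-≤ _ (length-listsWithSum≤ n A) ⟩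
      2 ^ (n + A) * (2 * s) ^ n              ∎
      where open ℕ.≤-Reasoning

    module _ .{{_ : NonZero s}} where

      quotient : ℤ → ℕ
      quotient x = ∣ x ∣ / s

      private
        divMod : ∀ m → m / s * s + m % s ≡ m
        divMod m = trans (ℕ.+-comm _ (m % s)) (sym (m≡m%n+[m/n]*n m s))

      ∈-withQuotient : ∀ x → x ∈ withQuotient (quotient x)
      ∈-withQuotient (+ m) = ∈-++⁺ˡ
        (subst (λ k → + k ∈ map (λ r → + (quotient (+ m) * s + r)) (upTo s))
          (divMod m) (∈-map⁺ _ (∈-upTo⁺ (m%n<n m s))))
      ∈-withQuotient -[1+ m ] = ∈-++⁺ʳ (map (λ r → + (quotient -[1+ m ] * s + r)) (upTo s))
        (subst (λ k → ℤ.- + k ∈ map (λ r → ℤ.- + (quotient -[1+ m ] * s + r)) (upTo s))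
          (divMod (suc m)) (∈-map⁺ _ (∈-upTo⁺ (m%n<n (suc m) s))))

      ∈-withQuotients : ∀ xs → xs ∈ withQuotients (map quotient xs)
      ∈-withQuotients []       = here refl
      ∈-withQuotients (x ∷ xs) =
        ∈-concatMap⁺ (λ y → map (y ∷_) (withQuotients (map quotient xs)))
          (lose (∈-withQuotient x) (∈-map⁺ (x ∷_) (∈-withQuotients xs)))

      ∈-keys : ∀ n A xs → length xs ≡ n → ℕ∑.∑ quotient xs ≤ A → xs ∈ keys n A
      ∈-keys n A xs |xs|≡n ∑≤A = ∈-concatMap⁺ withQuotients (lose
        (∈-listsWithSum≤ n A (map quotient xs) (trans (length-map quotient xs) |xs|≡n)
          (subst (_≤ A) (sym (ℕ∑.∑-map id quotient xs)) ∑≤A))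
        (∈-withQuotients xs))

      ∑quotient≤ : ∀ c l xs → l ≤ s * s → ‖ xs ‖² ≤ c * l → ℕ∑.∑ quotient xs ≤ c
      ∑quotient≤ c l xs l≤s² ‖xs‖²≤ = ℕ.≤-trans (∑-mono-≤ (λ x → m≤m*m (quotient x)) xs)
        (ℕ.*-cancelʳ-≤ _ c (s * s) {{ℕ.m*n≢0 s s}} (begin
          ℕ∑.∑ (λ x → quotient x * quotient x) xs * (s * s) ≡⟨ ℕ∑.*-distribʳ-∑ (s * s) _ xs ⟩
          ℕ∑.∑ (λ x → quotient x * quotient x * (s * s)) xs ≤⟨ ∑-mono-≤ q²s²≤|x|² xs ⟩
          ‖ xs ‖²                                           ≤⟨ ‖xs‖²≤ ⟩
          c * l                                             ≤⟨ ℕ.*-monoʳ-≤ c l≤s² ⟩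
          c * (s * s)                                       ∎))
        where
        open ℕ.≤-Reasoning
        m≤m*m : ∀ m → m ≤ m * m
        m≤m*m zero    = z≤n
        m≤m*m (suc m) = ℕ.m≤m*n (suc m) (suc m)
        interchange : ∀ a b → a * a * (b * b) ≡ a * b * (a * b)
        interchange = solve-∀
        q²s²≤|x|² : ∀ x → quotient x * quotient x * (s * s) ≤ ∣ x ∣ * ∣ x ∣
        q²s²≤|x|² x = ℕ.≤-trans (ℕ.≤-reflexive (interchange (quotient x) s))
          (ℕ.*-mono-≤ (m/n*n≤m ∣ x ∣ s) (m/n*n≤m ∣ x ∣ s))

module Arithmetic where

  open import Data.Nat using (_+_; _*_; _^_; _≤_; _≤?_; z≤n; s≤s)
  import Data.Nat.Properties as ℕ
  open import Data.Nat.Tactic.RingSolver using (solve-∀)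
  open import Relation.Binary.PropositionalEquality
    using (refl; sym; trans; cong; subst; module ≡-Reasoning)
  open import Relation.Nullary using (yes; no)

  ∃-square-between : ∀ l → 1 ≤ l → ∃[ s ] 1 ≤ s × l ≤ s * s × s * s ≤ 4 * l
  ∃-square-between (suc zero)    _ = 1 , ℕ.≤-refl , ℕ.≤-refl , s≤s z≤n
  ∃-square-between (suc (suc l)) _ with ∃-square-between (suc l) (s≤s z≤n)
  ... | s , 1≤s , l≤s² , s²≤4l with suc (suc l) ≤? s * s
  ...   | yes l+1≤s² =
    s , 1≤s , l+1≤s² , ℕ.≤-trans s²≤4l (ℕ.*-monoʳ-≤ 4 (ℕ.n≤1+n (suc l)))
  ...   | no  l+1≰s² = suc s , s≤s z≤n , lower , upper
    where
    open ℕ.≤-Reasoning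
    s²≡l : s * s ≡ suc l
    s²≡l = ℕ.≤-antisym (ℕ.≤-pred (ℕ.≰⇒> l+1≰s²)) l≤s²
    s+1≤2s : suc s ≤ 2 * s
    s+1≤2s = subst (suc s ≤_) (cong (_+_ s) (sym (ℕ.+-identityʳ s)))
               (subst (_≤ s + s) (ℕ.+-comm s 1) (ℕ.+-monoʳ-≤ s 1≤s))
    square-suc : ∀ s → suc s * suc s ≡ suc (s * s + 2 * s)
    square-suc = solve-∀
    square-double : ∀ s → 2 * s * (2 * s) ≡ 4 * (s * s)
    square-double = solve-∀
    lower : suc (suc l) ≤ suc s * suc s
    lower = begin
      suc (suc l)           ≡⟨ cong suc s²≡l ⟨
      suc (s * s)           ≤⟨ s≤s (ℕ.m≤m+n (s * s) (2 * s)) ⟩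
      suc (s * s + 2 * s)   ≡⟨ square-suc s ⟨
      suc s * suc s         ∎
    upper : suc s * suc s ≤ 4 * suc (suc l)
    upper = begin
      suc s * suc s         ≤⟨ ℕ.*-mono-≤ s+1≤2s s+1≤2s ⟩
      2 * s * (2 * s)       ≡⟨ square-double s ⟩
      4 * (s * s)           ≡⟨ cong (4 *_) s²≡l ⟩
      4 * suc l             ≤⟨ ℕ.*-monoʳ-≤ 4 (ℕ.n≤1+n (suc l)) ⟩
      4 * suc (suc l)       ∎

  ^-distribʳ-* : ∀ a b n → (a * b) ^ n ≡ a ^ n * b ^ n
  ^-distribʳ-* a b zero    = refl
  ^-distribʳ-* a b (suc n) = trans (cong (a * b *_) (^-distribʳ-* a b n)) (interchange a b (a ^ n) (b ^ n))
    where
    interchange : ∀ a b c d → a * b * (c * d) ≡ a * c * (b * d)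
    interchange = solve-∀

  2^[3n]*[2s]^n≡[16s]^n : ∀ n s → 2 ^ (n + 2 * n) * (2 * s) ^ n ≡ (16 * s) ^ n
  2^[3n]*[2s]^n≡[16s]^n n s = begin
    2 ^ (n + 2 * n) * (2 * s) ^ n ≡⟨ cong (λ m → 2 ^ m * (2 * s) ^ n) (3n n) ⟩
    2 ^ (3 * n) * (2 * s) ^ n     ≡⟨ cong (_* (2 * s) ^ n) (ℕ.^-*-assoc 2 3 n) ⟨
    8 ^ n * (2 * s) ^ n           ≡⟨ ^-distribʳ-* 8 (2 * s) n ⟨
    (8 * (2 * s)) ^ n             ≡⟨ cong (_^ n) (16s s) ⟩
    (16 * s) ^ n                  ∎
    where
    open ≡-Reasoning
    3n : ∀ n → n + 2 * n ≡ 3 * n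
    3n = solve-∀
    16s : ∀ s → 8 * (2 * s) ≡ 16 * s
    16s = solve-∀

  square-bound : ∀ N n f s l Z → 1 ≤ f → 1 ≤ n → s * s ≤ 4 * l →
                 2 ^ N ≤ 2 * ((16 * s) ^ n * Z) →
                 2 ^ (2 * N) ≤ Z * Z * (64 * f) ^ (2 * n) * l ^ n
  square-bound N n f s l Z 1≤f 1≤n s²≤4l 2^N≤ = begin
    2 ^ (2 * N)                              ≡⟨ ℕ.^-*-assoc 2 2 N ⟨
    (2 ^ 2) ^ N                              ≡⟨ ^-distribʳ-* 2 2 N ⟩
    2 ^ N * 2 ^ N                            ≤⟨ ℕ.*-mono-≤ 2^N≤ 2^N≤ ⟩
    2 * ((16 * s) ^ n * Z) * (2 * ((16 * s) ^ n * Z))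
      ≡⟨ e₁ ((16 * s) ^ n) Z ⟩
    4 * ((16 * s) ^ n * (16 * s) ^ n) * (Z * Z)
      ≡⟨ cong (λ m → 4 * m * (Z * Z)) (^-distribʳ-* (16 * s) (16 * s) n) ⟨
    4 * ((16 * s * (16 * s)) ^ n) * (Z * Z)  ≡⟨ cong (λ m → 4 * m ^ n * (Z * Z)) (e₂ s) ⟩
    4 * ((256 * (s * s)) ^ n) * (Z * Z)
      ≤⟨ ℕ.*-monoˡ-≤ (Z * Z) (ℕ.*-monoʳ-≤ 4 (ℕ.^-monoˡ-≤ n (ℕ.*-monoʳ-≤ 256 s²≤4l))) ⟩
    4 * ((256 * (4 * l)) ^ n) * (Z * Z)      ≡⟨ cong (λ m → 4 * m ^ n * (Z * Z)) (e₃ l) ⟩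
    4 * ((1024 * l) ^ n) * (Z * Z)
      ≡⟨ cong (λ m → 4 * m * (Z * Z)) (^-distribʳ-* 1024 l n) ⟩
    4 * (1024 ^ n * l ^ n) * (Z * Z)         ≡⟨ e₄ (1024 ^ n) (l ^ n) (Z * Z) ⟩
    Z * Z * (4 * 1024 ^ n) * l ^ n
      ≤⟨ ℕ.*-monoˡ-≤ (l ^ n) (ℕ.*-monoʳ-≤ (Z * Z) 4*1024^n≤) ⟩
    Z * Z * (64 * f) ^ (2 * n) * l ^ n       ∎
    where
    open ℕ.≤-Reasoning
    e₁ : ∀ P Z → 2 * (P * Z) * (2 * (P * Z)) ≡ 4 * (P * P) * (Z * Z)
    e₁ = solve-∀
    e₂ : ∀ s → 16 * s * (16 * s) ≡ 256 * (s * s)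
    e₂ = solve-∀
    e₃ : ∀ l → 256 * (4 * l) ≡ 1024 * l
    e₃ = solve-∀
    e₄ : ∀ a b c → 4 * (a * b) * c ≡ c * (4 * a) * b
    e₄ = solve-∀
    4*1024^n≤ : 4 * 1024 ^ n ≤ (64 * f) ^ (2 * n)
    4*1024^n≤ = begin
      4 * 1024 ^ n          ≤⟨ ℕ.*-monoˡ-≤ (1024 ^ n) (ℕ.^-monoʳ-≤ 4 1≤n) ⟩
      4 ^ n * 1024 ^ n      ≡⟨ ^-distribʳ-* 4 1024 n ⟨
      4096 ^ n
        ≤⟨ ℕ.^-monoˡ-≤ n (ℕ.*-mono-≤ (ℕ.*-monoʳ-≤ 64 1≤f) (ℕ.*-monoʳ-≤ 64 1≤f)) ⟩
      (64 * f * (64 * f)) ^ n ≡⟨ cong (λ m → (64 * f * m) ^ n) (ℕ.*-identityʳ (64 * f)) ⟨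
      ((64 * f) ^ 2) ^ n    ≡⟨ ℕ.^-*-assoc (64 * f) 2 n ⟩
      (64 * f) ^ (2 * n)    ∎

module LowerBound where

  open import Data.Nat using (_+_; _*_; _^_; _≤_; _<_; _∸_; z≤n; s≤s; NonZero; >-nonZero; _≤?_)
  import Data.Nat.Properties as ℕ
  open import Data.Integer as ℤ using (ℤ)
  open import Data.List.Membership.Propositional using (_∈_)
  open import Data.List.Membership.Propositional.Properties using (∈-filter⁻)
  import Data.List.Properties as List
  open import Data.List.Relation.Binary.Sublist.Propositional.Properties
    using (filter⁺; filter-⊆; length-mono-≤)
  open import Data.List.Relation.Unary.All using (All; []; _∷_)
  open import Data.Product using (proj₂)
  open import Relation.Binary.PropositionalEquality using (refl; sym; trans; cong; subst)
  open Enumerations using (length-allAssignments; length-allColumns)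
  open Energy using (‖_‖²; colSums; ∑‖colSums‖²; zeroEnergy?)
  open Counting using (half-≤-twice-mean; count; pigeonhole)
  open IntegerPoints using (keys; length-keys; ∈-keys; ∑quotient≤)
  open Arithmetic using (∃-square-between; 2^[3n]*[2s]^n≡[16s]^n; square-bound)

  map-≡⇒All : ∀ {A B : Set} (g h : A → B) xs → map g xs ≡ map h xs →
              All (λ x → g x ≡ h x) xs
  map-≡⇒All g h []       _  = []
  map-≡⇒All g h (x ∷ xs) eq = List.∷-injectiveˡ eq ∷ map-≡⇒All g h xs (List.∷-injectiveʳ eq)

  module _ (f l s : ℕ) .{{_ : NonZero s}} (l≤s² : l ≤ s * s) where

    private
      Ss : List (Assignment f l)
      Ss = allAssignments f l
      n : ℕ
      n = length (allColumns f l)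
      good? : Decidable (λ (S : Assignment f l) → ‖ colSums S ‖² ≤ 2 * (n * l))
      good? S = ‖ colSums S ‖² ≤? 2 * (n * l)
      typical : List (Assignment f l)
      typical = filter good? Ss
      _≟ᶜ_ : DecidableEquality (List ℤ)
      _≟ᶜ_ = List.≡-dec ℤ._≟_

    half-typical : length Ss ≤ 2 * length typical
    half-typical = half-≤-twice-mean (λ S → ‖ colSums S ‖²) (n * l) Ss
      (ℕ.≤-reflexive (trans (∑‖colSums‖² f l) (sym (ℕ.*-assoc n l (length Ss)))))

    0<typical : 0 < length typical
    0<typical = ℕ.≰⇒> (λ typical≤0 → ℕ.<⇒≱ (ℕ.m^n>0 2 (l ^ f))
      (ℕ.≤-trans (ℕ.≤-reflexive (sym (length-allAssignments f l)))
        (ℕ.≤-trans half-typical (ℕ.*-monoʳ-≤ 2 typical≤0))))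

    colSums∈keys : ∀ {S} → S ∈ typical → colSums S ∈ keys s n (2 * n)
    colSums∈keys {S} S∈ = ∈-keys s n (2 * n) (colSums S) (List.length-map _ (allColumns f l))
      (∑quotient≤ s (2 * n) l (colSums S) l≤s²
        (subst (‖ colSums S ‖² ≤_) (sym (ℕ.*-assoc 2 n l))
          (proj₂ (∈-filter⁻ good? {xs = Ss} S∈))))

    count≤nZE : ∀ S₀ → count colSums _≟ᶜ_ typical (colSums S₀) ≤ nZE f l (colSum S₀)
    count≤nZE S₀ = length-mono-≤
      (filter⁺ (λ S → colSums S ≟ᶜ colSums S₀) (zeroEnergy? f l (colSum S₀))
        (λ {S} → λ { refl → map-≡⇒All (colSum S) (colSum S₀) (allColumns f l) })
        (filter-⊆ good? Ss))

    ∃-frequent-colSums : ∃[ S₀ ] 2 ^ (l ^ f) ≤ 2 * ((16 * s) ^ n * nZE f l (colSum S₀))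
    ∃-frequent-colSums with pigeonhole colSums _≟ᶜ_ (keys s n (2 * n)) typical colSums∈keys 0<typical
    ... | S₀ , typical≤ = S₀ , (begin
      2 ^ (l ^ f)
        ≡⟨ length-allAssignments f l ⟨
      length Ss
        ≤⟨ half-typical ⟩
      2 * length typical
        ≤⟨ ℕ.*-monoʳ-≤ 2
             (ℕ.≤-trans typical≤ (ℕ.*-mono-≤ (length-keys s n (2 * n)) (count≤nZE S₀))) ⟩
      2 * (2 ^ (n + 2 * n) * (2 * s) ^ n * nZE f l (colSum S₀))
        ≡⟨ cong (λ m → 2 * (m * nZE f l (colSum S₀))) (2^[3n]*[2s]^n≡[16s]^n n s) ⟩
      2 * ((16 * s) ^ n * nZE f l (colSum S₀)) ∎)
      where open ℕ.≤-Reasoning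

  nZE-lower-bound : ∀ f l → 1 ≤ f → 1 ≤ l → ∃[ M ] (2 ^ (2 * l ^ f)
    ≤ nZE f l M * nZE f l M * (64 * f) ^ (2 * (f * l ^ (f ∸ 1))) * l ^ (f * l ^ (f ∸ 1)))
  nZE-lower-bound (suc g) l 1≤f 1≤l =
    let s , 1≤s , l≤s² , s²≤4l = ∃-square-between l 1≤l
        S₀ , 2^N≤ = ∃-frequent-colSums (suc g) l s {{>-nonZero 1≤s}} l≤s²
        Z = nZE (suc g) l (colSum S₀)
    in colSum S₀ , subst (λ m → 2 ^ (2 * l ^ suc g) ≤ Z * Z * (64 * suc g) ^ (2 * m) * l ^ m)
         (length-allColumns g l) (square-bound (l ^ suc g) n (suc g) s l Z 1≤f 1≤n s²≤4l 2^N≤)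
    where
    n : ℕ
    n = length (allColumns (suc g) l)
    1≤n : 1 ≤ n
    1≤n = subst (1 ≤_) (sym (length-allColumns g l))
      (ℕ.*-mono-≤ 1≤f (subst (_≤ l ^ g) (ℕ.^-zeroˡ g) (ℕ.^-monoˡ-≤ g 1≤l)))

open import Data.Nat using (_≤_; _*_; _^_; _∸_; s≤s; z≤n)
open import Data.Nat.Divisibility using (_∣_)
open import Data.Integer using (ℤ)

lemma3 : ((f l : ℕ) → 1 ≤ f → 1 ≤ l → 2 ∣ l → (M : Column f l → ℤ) →
            0 < nZE f l M → nGM f l M ≡ nZE f l M)
         × (∃[ k ] (1 ≤ k × ((f l : ℕ) → 1 ≤ f → 1 ≤ l → 2 ∣ l →
            ∃[ M ] (2 ^ (2 * l ^ f)
              ≤ nZE f l M * nZE f l M * (k * f) ^ (2 * (f * l ^ (f ∸ 1))) * l ^ (f * l ^ (f ∸ 1))))))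
lemma3 = (λ f l _ _ _ M → Energy.nGM≡nZE f l M)
       , 64 , s≤s z≤n , (λ f l 1≤f 1≤l _ → LowerBound.nZE-lower-bound f l 1≤f 1≤l)
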